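{- Let $l>m\ge3$ be integers. Then there is a finite graph $G$ and positive integers $a,b,c,d$ with $\frac{c}{d}=l$ and $\frac{a}{b}=m$ such that $G$ is $(a:b)$-choosable but not $(c:d)$-choosable.
   Context: A graph $G=(V,E)$ is $(a:b)$-choosable if for every family of sets $\{S(v):v\in V\}$ with $|S(v)|=a$ for all $v$, there are subsets $C(v)\subseteq S(v)$ with $|C(v)|=b$ for all $v$ and $C(u)\cap C(v)=\emptyset$ for every two adjacent $u,v$. -}

module Defs where

open import Data.Nat using (ℕ; _*_)
open import Data.Fin using (Fin)
open import Data.Bool using (Bool; true; false)
open import Data.List using (List; length)
open import Data.List.Relation.Unary.Unique.Propositional using (Unique)
open import Data.List.Membership.Propositional using (_∈_)
open import Data.Product using (Σ; _×_)
open import Relation.Binary.PropositionalEquality using (_≡_)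
open import Relation.Nullary using (¬_)

record Graph : Set where
  field
    n     : ℕ
    adj   : Fin n → Fin n → Bool
    sym   : ∀ u v → adj u v ≡ adj v u
    irrefl : ∀ v → adj v v ≡ false

open Graph public

FinSetOfSize : ℕ → List ℕ → Set
FinSetOfSize k xs = Unique xs × length xs ≡ k

_⊆_ : List ℕ → List ℕ → Set
xs ⊆ ys = ∀ {x} → x ∈ xs → x ∈ ys

Disjoint : List ℕ → List ℕ → Set
Disjoint xs ys = ∀ {x} → x ∈ xs → ¬ (x ∈ ys)

Choosable : Graph → ℕ → ℕ → Set
Choosable G a b =
  (S : Fin (n G) → List ℕ) → (∀ v → FinSetOfSize a (S v)) →
  Σ (Fin (n G) → List ℕ) λ C →
    (∀ v → FinSetOfSize b (C v) × C v ⊆ S v) ×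
    (∀ u v → adj G u v ≡ true → Disjoint (C u) (C v))

module Submission where

-- Let l > m ≥ 3.  The witness graph is the complete bipartite graph
-- K = K_{l, l^l} on N = l + l^l vertices; we show that K is
-- (m·2^N : 2^N)-choosable but not (l : 1)-choosable.
--
-- Non-choosability is the classical list assignment: the colours are the
-- cells (i, j) of an l × l grid, left vertex i receives row i, and the right
-- vertices are indexed by the functions g : Fin l → Fin l, vertex g receiving
-- the graph {(i, g i)}.  Whatever colour each left vertex i picks is a cell
-- (i, g i); the right vertex g then has only colours already used by its
-- left neighbours.
--
-- Choosability holds for every bipartite graph on N vertices and rests on a
-- discrepancy bound: for k sets A₁ … A_k of colours there is a splitting X of
-- all colours such that every Aᵢ has |Aᵢ ∩ X| and |Aᵢ ∖ X| within 2^k of each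
-- other (split the universe along A₁, recurse on both halves with the
-- remaining sets, and glue; a single set is balanced greedily within 1).
-- Applied to the N lists, each list (of size m·2^N, m ≥ 3) has at least 2^N
-- colours on both sides of X; left vertices choose from X, right ones from
-- its complement.

open import Defs
open import Data.Nat using (ℕ; _<_; _≤_; _*_; NonZero)
open import Data.Product using (Σ; _×_)
open import Relation.Binary.PropositionalEquality using (_≡_)
open import Relation.Nullary using (¬_)

open import Data.Nat using (zero; suc; _+_; _^_; z≤n; s≤s; _≤?_; _≟_)
open import Data.Nat.Properties
  using (+-identityʳ; +-comm; +-suc; +-mono-≤; +-monoʳ-≤; +-mono-<; +-monoˡ-<; *-mono-≤; *-monoˡ-≤; *-identityʳ; m<n⇒0<n;
         ≤-trans; n≤1+n; m≤m+n; ≰⇒>; <-irrefl; m≤n⇒m⊓n≡m; m^n>0; +-commutativeSemigroup;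
         module ≤-Reasoning)
open import Algebra.Properties.CommutativeSemigroup +-commutativeSemigroup using (interchange)
open import Data.Bool using (Bool; true; false; not; _∧_; _∨_; _xor_; if_then_else_; T; T?)
open import Data.Bool.Properties using (∧-comm; ∧-idem; ∧-inverseʳ; xor-comm; xor-same; T-≡; T-not-≡)
open import Data.Fin using (Fin; zero; suc; toℕ; splitAt; _↑ˡ_; _↑ʳ_; combine; finToFun; funToFin)
open import Data.Fin.Properties
  using (splitAt-↑ˡ; splitAt-↑ʳ; combine-injectiveˡ; combine-injectiveʳ; toℕ-injective; finToFun-funToFin)
open import Data.Sum using (inj₁; inj₂; [_,_])
open import Data.List using (List; []; _∷_; length; tabulate; concat; deduplicate; filterᵇ; take)
open import Data.List.Properties using (length-tabulate; length-take)
open import Data.List.Membership.Propositional using (_∈_)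
open import Data.List.Membership.Propositional.Properties
  using (∈-tabulate⁺; ∈-tabulate⁻; ∈-concat⁺′; ∈-deduplicate⁺; ∈-filter⁻)
open import Data.List.Relation.Unary.Any using (here; there)
open import Data.List.Relation.Unary.All as All using (All)
open import Data.List.Relation.Unary.AllPairs using ([]; _∷_)
open import Data.List.Relation.Unary.Unique.Propositional using (Unique)
open import Data.List.Relation.Unary.Unique.Propositional.Properties using (tabulate⁺; take⁺; filter⁺)
open import Data.List.Relation.Unary.Unique.DecPropositional.Properties _≟_ using (deduplicate-!)
import Data.List.Relation.Binary.Sublist.Propositional as Sublist
import Data.List.Relation.Binary.Sublist.Propositional.Properties as Sublist
open import Data.Product using (_,_; proj₁; proj₂)
open import Function using (_∘_; Equivalence)
open import Relation.Binary.PropositionalEquality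
  using (refl; trans; cong; cong₂; subst; subst₂; _≢_; module ≡-Reasoning) renaming (sym to ≡-sym)
open import Relation.Nullary using (yes; no; does; contradiction)
open import Relation.Nullary.Decidable using (dec-true; dec-false)

ColourSet : Set
ColourSet = ℕ → Bool

_∩_ : ColourSet → ColourSet → ColourSet
(p ∩ q) x = p x ∧ q x

∁ : ColourSet → ColourSet
∁ p x = not (p x)

∅ : ColourSet
∅ _ = false

everything : ColourSet
everything _ = true

is : ℕ → ColourSet
is s x = does (x ≟ s)

mem : List ℕ → ColourSet
mem []       x = false
mem (y ∷ ys) x = is y x ∨ mem ys x

is-absent : ∀ {y x} {U : List ℕ} → All (y ≢_) U → x ∈ U → is y x ≡ false
is-absent {y} {x} y∉U x∈U = dec-false (x ≟ y) λ { refl → All.lookup y∉U x∈U refl }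

mem-∉ : ∀ {s} S → All (s ≢_) S → mem S s ≡ false
mem-∉ []      _                = refl
mem-∉ (y ∷ S) (s≢y All.∷ s∉S) rewrite dec-false (_ ≟ y) s≢y = mem-∉ S s∉S

choose : ColourSet → ColourSet → ColourSet → ColourSet
choose a X₁ X₂ x = if a x then X₁ x else X₂ x

indicator : Bool → ℕ
indicator true  = 1
indicator false = 0

count : ColourSet → List ℕ → ℕ
count p []       = 0
count p (x ∷ xs) = indicator (p x) + count p xs

count-cong : ∀ {p q} (U : List ℕ) → (∀ {x} → x ∈ U → p x ≡ q x) → count p U ≡ count q U
count-cong []      _  = refl
count-cong (x ∷ U) eq = cong₂ _+_ (cong indicator (eq (here refl))) (count-cong U (eq ∘ there))

count-split : ∀ {p q r} → (∀ x → indicator (p x) ≡ indicator (q x) + indicator (r x)) →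
              ∀ U → count p U ≡ count q U + count r U
count-split           split []      = refl
count-split {p} {q} {r} split (x ∷ U) = begin
  indicator (p x) + count p U                                   ≡⟨ cong₂ _+_ (split x) (count-split split U) ⟩
  (indicator (q x) + indicator (r x)) + (count q U + count r U)
    ≡⟨ interchange (indicator (q x)) (indicator (r x)) (count q U) (count r U) ⟩
  (indicator (q x) + count q U) + (indicator (r x) + count r U) ∎
  where open ≡-Reasoning

count-∅ : ∀ U → count ∅ U ≡ 0
count-∅ []      = refl
count-∅ (_ ∷ U) = count-∅ U

count-complement : ∀ X U → count X U + count (∁ X) U ≡ length U
count-complement X []      = refl
count-complement X (x ∷ U) with X x
... | true  = cong suc (count-complement X U)
... | false = trans (+-suc (count X U) (count (∁ X) U)) (cong suc (count-complement X U))

length-filterᵇ : ∀ p U → length (filterᵇ p U) ≡ count p U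
length-filterᵇ p []      = refl
length-filterᵇ p (x ∷ U) with p x
... | true  = cong suc (length-filterᵇ p U)
... | false = length-filterᵇ p U

Near : ℕ → ℕ → ℕ → Set
Near D x y = x ≤ y + D × y ≤ x + D

Near-+ : ∀ {D E x y x′ y′} → Near D x y → Near E x′ y′ → Near (D + E) (x + x′) (y + y′)
Near-+ {D} {E} {x} {y} {x′} {y′} (x≤ , y≤) (x′≤ , y′≤) =
  subst (x + x′ ≤_) (interchange y D y′ E) (+-mono-≤ x≤ x′≤) ,
  subst (y + y′ ≤_) (interchange x D x′ E) (+-mono-≤ y≤ y′≤)

Near-1-extend : ∀ {x y} → Near 1 x y → Σ Bool λ β → Near 1 (indicator β + x) (indicator (not β) + y)
Near-1-extend {x} {y} (x≤y+1 , y≤x+1) with x ≤? y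
... | yes x≤y = true  , subst (suc x ≤_) (+-comm 1 y) (s≤s x≤y) , ≤-trans y≤x+1 (n≤1+n _)
... | no  x≰y = false , ≤-trans x≤y+1 (n≤1+n _) , ≤-trans (≰⇒> x≰y) (m≤m+n x 1)

Balanced : ℕ → ColourSet → ColourSet → List ℕ → Set
Balanced D p X U = Near D (count (p ∩ X) U) (count (p ∩ ∁ X) U)

Balanced-cong : ∀ {D p q X} U → (∀ x → p x ≡ q x) → Balanced D p X U → Balanced D q X U
Balanced-cong {D} {p} {q} {X} U p≗q =
  subst₂ (Near D) (count-cong U (λ {x} _ → cong (_∧ X x) (p≗q x)))
                  (count-cong U (λ {x} _ → cong (_∧ not (X x)) (p≗q x)))

Balanced-∅ : ∀ D X U → Balanced D ∅ X U
Balanced-∅ D X U = subst₂ (Near D) (≡-sym (count-∅ U)) (≡-sym (count-∅ U)) (z≤n , z≤n)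

Balanced-glue : ∀ {D E} r a X₁ X₂ U → Balanced D (r ∩ a) X₁ U → Balanced E (r ∩ ∁ a) X₂ U →
                Balanced (D + E) r (choose a X₁ X₂) U
Balanced-glue r a X₁ X₂ U bal₁ bal₂ =
  subst₂ (Near _) (≡-sym (count-split (piece (λ b → b)) U)) (≡-sym (count-split (piece not) U))
         (Near-+ bal₁ bal₂)
  where
  piece : ∀ (f : Bool → Bool) x →
          indicator (r x ∧ f (choose a X₁ X₂ x)) ≡
          indicator ((r x ∧ a x) ∧ f (X₁ x)) + indicator ((r x ∧ not (a x)) ∧ f (X₂ x))
  piece f x with r x | a x
  ... | false | _     = refl
  ... | true  | true  = ≡-sym (+-identityʳ _)
  ... | true  | false = refl

-- A single set p can be balanced within 1 on any duplicate-free list: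
-- go through the list, putting each element on the currently smaller side.
balance-one : (U : List ℕ) → Unique U → (p : ColourSet) → Σ ColourSet λ X → Balanced 1 p X U
balance-one []      _             p = ∅ , z≤n , z≤n
balance-one (y ∷ U) (y∉U ∷ uniq) p with balance-one U uniq p
... | X′ , bal with Near-1-extend bal
... | β , bal′ = X , balanced
  where
  X : ColourSet
  X x = if is y x then β else X′ x

  -- X differs from X′ only at y, which does not occur in U
  agrees : ∀ {x} → x ∈ U → X x ≡ X′ x
  agrees {x} x∈U = cong (if_then β else X′ x) (is-absent y∉U x∈U)

  balanced : Balanced 1 p X (y ∷ U)
  balanced
    rewrite dec-true (y ≟ y) refl
          | count-cong {p ∩ X}   {p ∩ X′}   U (λ x∈U → cong (p _ ∧_) (agrees x∈U))
          | count-cong {p ∩ ∁ X} {p ∩ ∁ X′} U (λ x∈U → cong (λ b → p _ ∧ not b) (agrees x∈U))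
    with p y
  ... | true  = bal′
  ... | false = bal

∧-swapʳ : ∀ u a q → (u ∧ a) ∧ q ≡ (u ∧ q) ∧ a
∧-swapʳ false a q = refl
∧-swapʳ true  a q = ∧-comm a q

∧-absorbʳ : ∀ u a → u ∧ a ≡ (u ∧ a) ∧ a
∧-absorbʳ false a = refl
∧-absorbʳ true  a = ≡-sym (∧-idem a)

∧-disjointʳ : ∀ u a → false ≡ (u ∧ a) ∧ not a
∧-disjointʳ false a = refl
∧-disjointʳ true  a = ≡-sym (∧-inverseʳ a)

doubling : ∀ k → 2 ^ k + 2 ^ k ≡ 2 ^ suc k
doubling k = cong (2 ^ k +_) (≡-sym (+-identityʳ (2 ^ k)))

-- Split u along A 0, balance
-- both parts with respect to the remaining k - 1 sets, and glue.
balance-family : (U : List ℕ) → Unique U → (k : ℕ) (A : Fin k → ColourSet) (u : ColourSet) →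
  Σ ColourSet λ X → Balanced (2 ^ k) u X U × (∀ i → Balanced (2 ^ k) (u ∩ A i) X U)
balance-family U uniq zero A u with balance-one U uniq u
... | X , bal = X , bal , λ ()
balance-family U uniq (suc k) A u
  with balance-family U uniq k (A ∘ suc) (u ∩ A zero)
     | balance-family U uniq k (A ∘ suc) (u ∩ ∁ (A zero))
... | X₁ , inside₁ , each₁ | X₂ , inside₂ , each₂ =
  X , double (Balanced-glue u a X₁ X₂ U inside₁ inside₂) , double ∘ each
  where
  a : ColourSet
  a = A zero
  X : ColourSet
  X = choose a X₁ X₂

  double : ∀ {p} → Balanced (2 ^ k + 2 ^ k) p X U → Balanced (2 ^ suc k) p X U
  double {p} = subst (λ D → Balanced D p X U) (doubling k)

  each : ∀ i → Balanced (2 ^ k + 2 ^ k) (u ∩ A i) X U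
  -- u ∩ a is all on the X₁ part and nothing on the X₂ part
  each zero    = Balanced-glue (u ∩ a) a X₁ X₂ U
                   (Balanced-cong U (λ x → ∧-absorbʳ (u x) (a x)) inside₁)
                   (Balanced-cong U (λ x → ∧-disjointʳ (u x) (a x)) (Balanced-∅ _ X₂ U))
  -- u ∩ A (suc i) splits into (u ∩ a) ∩ A (suc i) and (u ∖ a) ∩ A (suc i)
  each (suc i) = Balanced-glue (u ∩ A (suc i)) a X₁ X₂ U
                   (Balanced-cong U (λ x → ∧-swapʳ (u x) (a x) (A (suc i) x)) (each₁ i))
                   (Balanced-cong U (λ x → ∧-swapʳ (u x) (not (a x)) (A (suc i) x)) (each₂ i))

count-singleton : ∀ f {s} U → Unique U → s ∈ U → count (is s ∩ f) U ≡ indicator (f s)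
count-singleton f {s} (y ∷ U) (y∉U ∷ _) (here refl) rewrite dec-true (y ≟ y) refl =
  trans (cong (indicator (f y) +_) absent) (+-identityʳ _)
  where
  absent : count (is y ∩ f) U ≡ 0
  absent = trans (count-cong U λ {x} x∈U → cong (_∧ f x) (is-absent y∉U x∈U)) (count-∅ U)
count-singleton f {s} (y ∷ U) (y∉U ∷ uniq) (there s∈U)
  rewrite dec-false (y ≟ s) (All.lookup y∉U s∈U) = count-singleton f U uniq s∈U

count-restrict : ∀ f S U → Unique S → Unique U → S ⊆ U → count f S ≡ count (mem S ∩ f) U
count-restrict f []      U _             _     _    = ≡-sym (count-∅ U)
count-restrict f (s ∷ S) U (s∉S ∷ uniqS) uniqU S⊆U = begin
  indicator (f s) + count f S
    ≡⟨ cong₂ _+_ (≡-sym (count-singleton f U uniqU (S⊆U (here refl))))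
                 (count-restrict f S U uniqS uniqU (S⊆U ∘ there)) ⟩
  count (is s ∩ f) U + count (mem S ∩ f) U
    ≡⟨ ≡-sym (count-split split U) ⟩
  count (mem (s ∷ S) ∩ f) U ∎
  where
  open ≡-Reasoning
  -- s is not an entry of S, so {s} and the entries of S are disjoint
  split : ∀ x → indicator ((is s x ∨ mem S x) ∧ f x) ≡ indicator (is s x ∧ f x) + indicator (mem S x ∧ f x)
  split x with x ≟ s
  ... | no  x≢s  rewrite dec-false (x ≟ s) x≢s = refl
  ... | yes refl rewrite dec-true (s ≟ s) refl | mem-∉ S s∉S = ≡-sym (+-identityʳ _)

Balanced-restrict : ∀ {D X S U} → Unique S → Unique U → S ⊆ U →
                    Balanced D (mem S) X U → Near D (count X S) (count (∁ X) S)
Balanced-restrict {D} {X} {S} {U} uniqS uniqU S⊆U =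
  subst₂ (Near D) (≡-sym (count-restrict X S U uniqS uniqU S⊆U))
                  (≡-sym (count-restrict (∁ X) S U uniqS uniqU S⊆U))

colour-universe : ∀ {N} (S : Fin N → List ℕ) → Σ (List ℕ) λ U → Unique U × (∀ v → S v ⊆ U)
colour-universe S =
  deduplicate _≟_ (concat (tabulate S)) , deduplicate-! _ ,
  λ v x∈Sv → ∈-deduplicate⁺ _≟_ (∈-concat⁺′ x∈Sv (∈-tabulate⁺ v))

-- If x + y = m·D with m ≥ 3 and y ≤ x + D, then x ≥ D: otherwise
-- m·D = x + y ≤ 2x + D < 3D.
near-part-large : ∀ {m D x y} → 3 ≤ m → y ≤ x + D → x + y ≡ m * D → D ≤ x
near-part-large {m} {D} {x} {y} 3≤m y≤x+D total with D ≤? x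
... | yes D≤x = D≤x
... | no  D≰x = contradiction (begin-strict
      m * D        ≡⟨ ≡-sym total ⟩
      x + y        ≤⟨ +-monoʳ-≤ x y≤x+D ⟩
      x + (x + D)  <⟨ +-mono-< x<D (+-monoˡ-< D x<D) ⟩
      D + (D + D)  ≡⟨ cong (λ z → D + (D + z)) (≡-sym (+-identityʳ D)) ⟩
      3 * D        ≤⟨ *-monoˡ-≤ D 3≤m ⟩
      m * D        ∎) (<-irrefl refl)
  where
  open ≤-Reasoning
  x<D : x < D
  x<D = ≰⇒> D≰x

half : ColourSet → Bool → ColourSet
half X true  = X
half X false = ∁ X

half-value : ∀ X s x → T (half X s x) → X x ≡ s
half-value X true  x = Equivalence.to T-≡
half-value X false x = Equivalence.to T-not-≡

halves-large : ∀ {m D} X S → 3 ≤ m → Near D (count X S) (count (∁ X) S) → length S ≡ m * D →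
               ∀ s → D ≤ count (half X s) S
halves-large X S 3≤m (_ , y≤x+D) size true  =
  near-part-large 3≤m y≤x+D (trans (count-complement X S) size)
halves-large X S 3≤m (x≤y+D , _) size false =
  near-part-large 3≤m x≤y+D (trans (+-comm (count (∁ X) S) (count X S)) (trans (count-complement X S) size))

first-in : ℕ → ColourSet → List ℕ → List ℕ
first-in b p L = take b (filterᵇ p L)

first-in-size : ∀ b p L → Unique L → b ≤ count p L → FinSetOfSize b (first-in b p L)
first-in-size b p L uniq enough =
  take⁺ b (filter⁺ (T? ∘ p) uniq) ,
  trans (length-take b (filterᵇ p L)) (m≤n⇒m⊓n≡m (subst (b ≤_) (≡-sym (length-filterᵇ p L)) enough))

first-in-members : ∀ b p L {x} → x ∈ first-in b p L → x ∈ L × T (p x)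
first-in-members b p L x∈ = ∈-filter⁻ (T? ∘ p) (Sublist.lookup (Sublist.take-⊆ b (filterᵇ p L)) x∈)

-- Every bipartite graph on N vertices is (m·2^N : 2^N)-choosable for m ≥ 3:
-- split the colours so that every list is balanced within 2^N; then each
-- list has 2^N colours in each half, and vertices of side s choose from half s.
bipartite-choosable : (G : Graph) (side : Fin (n G) → Bool) →
  (∀ u v → adj G u v ≡ true → side u ≢ side v) →
  ∀ m → 3 ≤ m → Choosable G (m * 2 ^ n G) (2 ^ n G)
bipartite-choosable G side proper m 3≤m S sizes = C , chosen , disjoint
  where
  D : ℕ
  D = 2 ^ n G

  universe : Σ (List ℕ) λ U → Unique U × (∀ v → S v ⊆ U)
  universe = colour-universe S
  U : List ℕ
  U = proj₁ universe
  uniqU : Unique U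
  uniqU = proj₁ (proj₂ universe)
  lists⊆U : ∀ v → S v ⊆ U
  lists⊆U = proj₂ (proj₂ universe)

  splitting : Σ ColourSet λ X → Balanced D everything X U × (∀ v → Balanced D (mem (S v)) X U)
  splitting = balance-family U uniqU (n G) (mem ∘ S) everything
  X : ColourSet
  X = proj₁ splitting

  near : ∀ v → Near D (count X (S v)) (count (∁ X) (S v))
  near v = Balanced-restrict (proj₁ (sizes v)) uniqU (lists⊆U v) (proj₂ (proj₂ splitting) v)

  C : Fin (n G) → List ℕ
  C v = first-in D (half X (side v)) (S v)

  chosen : ∀ v → FinSetOfSize D (C v) × C v ⊆ S v
  chosen v = first-in-size D _ (S v) (proj₁ (sizes v))
               (halves-large X (S v) 3≤m (near v) (proj₂ (sizes v)) (side v)) ,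
             proj₁ ∘ first-in-members D _ (S v)

  disjoint : ∀ u v → adj G u v ≡ true → Disjoint (C u) (C v)
  disjoint u v uv x∈Cu x∈Cv = proper u v uv (trans (≡-sym (value u x∈Cu)) (value v x∈Cv))
    where
    value : ∀ w {x} → x ∈ C w → X x ≡ side w
    value w x∈Cw = half-value X (side w) _ (proj₂ (first-in-members D _ (S w) x∈Cw))

xor-distinct : ∀ a b → a xor b ≡ true → a ≢ b
xor-distinct a .a same refl = contradiction (trans (≡-sym (xor-same a)) same) λ ()

-- The complete bipartite graph K_{p,q}: of the vertices Fin (p + q) the
-- first p form the left side.
left : ∀ p {q} → Fin (p + q) → Bool
left p v = [ (λ _ → true) , (λ _ → false) ] (splitAt p v)

K : ℕ → ℕ → Graph
K p q = record
  { n      = p + q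
  ; adj    = λ u v → left p u xor left p v
  ; sym    = λ u v → xor-comm (left p u) (left p v)
  ; irrefl = λ v → xor-same (left p v)
  }

K-bipartite : ∀ p q u v → adj (K p q) u v ≡ true → left p u ≢ left p v
K-bipartite p q u v = xor-distinct (left p u) (left p v)

element : ∀ {L : List ℕ} → FinSetOfSize 1 L → Σ ℕ λ x → x ∈ L
element {x ∷ _} _ = x , here refl

-- The colours are the cells of an l × l
-- grid; left vertex i gets row i, right vertex r gets the graph of the
-- function g = finToFun r.  If each left vertex i picks cell (i, g i), the
-- right vertex for g finds its colours all taken by its left neighbours.
module GridLists (l : ℕ) where
  cell : Fin l → Fin l → ℕ
  cell i j = toℕ (combine i j)

  row : Fin l → List ℕ
  row i = tabulate (cell i)

  graph-of : Fin (l ^ l) → List ℕ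
  graph-of r = tabulate (λ i → cell i (finToFun r i))

  lists : Fin (l + l ^ l) → List ℕ
  lists v = [ row , graph-of ] (splitAt l v)

  lists-size : ∀ v → FinSetOfSize l (lists v)
  lists-size v with splitAt l v
  ... | inj₁ i = tabulate⁺ (λ e → combine-injectiveʳ i _ i _ (toℕ-injective e)) , length-tabulate _
  ... | inj₂ r = tabulate⁺ (λ e → combine-injectiveˡ _ _ _ _ (toℕ-injective e)) , length-tabulate _

  lists-left : ∀ i → lists (i ↑ˡ l ^ l) ≡ row i
  lists-left i = cong [ row , graph-of ] (splitAt-↑ˡ l i (l ^ l))

  lists-right : ∀ r → lists (l ↑ʳ r) ≡ graph-of r
  lists-right r = cong [ row , graph-of ] (splitAt-↑ʳ l (l ^ l) r)

  K-not-choosable : ¬ Choosable (K l (l ^ l)) l 1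
  K-not-choosable choosable with choosable lists lists-size
  ... | C , chosen , disjoint =
    disjoint (i ↑ˡ l ^ l) (l ↑ʳ r) adjacent (proj₂ (colour (i ↑ˡ l ^ l))) same-colour
    where
    colour : ∀ v → Σ ℕ λ x → x ∈ C v
    colour v = element (proj₁ (chosen v))

    c : Fin (l + l ^ l) → ℕ
    c v = proj₁ (colour v)

    c-in-list : ∀ v → c v ∈ lists v
    c-in-list v = proj₂ (chosen v) (proj₂ (colour v))

    in-row : ∀ i → Σ (Fin l) λ j → c (i ↑ˡ l ^ l) ≡ cell i j
    in-row i = ∈-tabulate⁻ (subst (c (i ↑ˡ l ^ l) ∈_) (lists-left i) (c-in-list (i ↑ˡ l ^ l)))

    g : Fin l → Fin l
    g i = proj₁ (in-row i)

    r : Fin (l ^ l)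
    r = funToFin g

    in-graph : Σ (Fin l) λ i → c (l ↑ʳ r) ≡ cell i (finToFun r i)
    in-graph = ∈-tabulate⁻ (subst (c (l ↑ʳ r) ∈_) (lists-right r) (c-in-list (l ↑ʳ r)))

    i : Fin l
    i = proj₁ in-graph

    same-colour : c (i ↑ˡ l ^ l) ∈ C (l ↑ʳ r)
    same-colour = subst (_∈ C (l ↑ʳ r)) (begin
      c (l ↑ʳ r)             ≡⟨ proj₂ in-graph ⟩
      cell i (finToFun r i)  ≡⟨ cong (cell i) (finToFun-funToFin g i) ⟩
      cell i (g i)           ≡⟨ ≡-sym (proj₂ (in-row i)) ⟩
      c (i ↑ˡ l ^ l)         ∎) (proj₂ (colour (l ↑ʳ r)))
      where open ≡-Reasoning

    adjacent : adj (K l (l ^ l)) (i ↑ˡ l ^ l) (l ↑ʳ r) ≡ true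
    adjacent rewrite splitAt-↑ˡ l i (l ^ l) | splitAt-↑ʳ l (l ^ l) r = refl

corollary2p1 : (l m : ℕ) → 3 ≤ m → m < l →
    Σ Graph λ G → Σ ℕ λ a → Σ ℕ λ b → Σ ℕ λ c → Σ ℕ λ d →
      (0 < a) × (0 < b) × (0 < c) × (0 < d) ×
      (c ≡ l * d) × (a ≡ m * b) ×
      Choosable G a b × ¬ Choosable G c d
corollary2p1 l m 3≤m m<l =
  G , m * b , b , l , 1 ,
  *-mono-≤ (≤-trans (s≤s z≤n) 3≤m) 0<b , 0<b , m<n⇒0<n m<l , s≤s z≤n ,
  ≡-sym (*-identityʳ l) , refl ,
  bipartite-choosable G (left l) (K-bipartite l (l ^ l)) m 3≤m ,
  GridLists.K-not-choosable l
  where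
  G : Graph
  G = K l (l ^ l)
  b : ℕ
  b = 2 ^ n G
  0<b : 0 < b
  0<b = m^n>0 2 (n G)
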